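{- For every function $f:\mathbb{N}\to\mathbb{N}$ and every $n\in\mathbb{N}$ we have (i) $I^{n+1}_f=\mathcal{F}(1^{f(0)}0\,1^{f(1)}0\cdots1^{f(n)}0)$ and (ii) $J^{n+1}_f=\mathcal{F}(0^{f(0)}1\,0^{f(1)}1\cdots0^{f(n)}1)$.
   Context: The Farey pair tree $\mathcal{F}$ assigns to each $\sigma\in\{0,1\}^*$ a pair of fractions: $\mathcal{F}(\epsilon)=(0/1,1/1)$, and if $\mathcal{F}(\sigma)=(a/b,c/d)$ then $\mathcal{F}(\sigma0)=(a/b,(a+c)/(b+d))$ and $\mathcal{F}(\sigma1)=((a+c)/(b+d),c/d)$; $x^k$ denotes the string of $k$ copies of the symbol $x$. For $f:\mathbb{N}\to\mathbb{N}$ define $I^0_f=J^0_f=(0/1,1/1)$, and if $I^n_f=(a/b,c/d)$ then $I^{n+1}_f=\left(\frac{a+f(n)c}{b+f(n)d},\frac{a+f(n)c+c}{b+f(n)d+d}\right)$, and if $J^n_f=(a/b,c/d)$ then $J^{n+1}_f=\left(\frac{a+f(n)a+c}{b+f(n)b+d},\frac{f(n)a+c}{f(n)b+d}\right)$. -}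

module Defs where

open import Data.Nat using (ℕ; zero; suc; _+_; _*_)
open import Data.Bool using (Bool; true; false)
open import Data.List using (List; []; _∷_; _++_; replicate; foldr)
open import Data.Product using (_×_; _,_)

-- A fraction a/b is represented formally by its numerator/denominator pair (a , b).
Frac : Set
Frac = ℕ × ℕ

FracPair : Set
FracPair = Frac × Frac

-- bits: false = 0, true = 1
Bit : Set
Bit = Bool

mediant : Frac → Frac → Frac
mediant (a , b) (c , d) = (a + c , b + d)

fstep : FracPair → Bit → FracPair
fstep (x , y) false = (x , mediant x y)
fstep (x , y) true  = (mediant x y , y)

farey-from : FracPair → List Bit → FracPair
farey-from p []       = p
farey-from p (b ∷ σ) = farey-from (fstep p b) σ

root : FracPair
root = ((0 , 1) , (1 , 1))

F : List Bit → FracPair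
F = farey-from root

I : (ℕ → ℕ) → ℕ → FracPair
I f zero = root
I f (suc n) with I f n
... | ((a , b) , (c , d)) =
  ((a + f n * c , b + f n * d) , (a + f n * c + c , b + f n * d + d))

J : (ℕ → ℕ) → ℕ → FracPair
J f zero = root
J f (suc n) with J f n
... | ((a , b) , (c , d)) =
  ((a + f n * a + c , b + f n * b + d) , (f n * a + c , f n * b + d))

blocks : (ℕ → List Bit) → ℕ → List Bit
blocks w zero    = w zero
blocks w (suc n) = blocks w n ++ w (suc n)

wordI : (ℕ → ℕ) → ℕ → List Bit
wordI f = blocks (λ k → replicate (f k) true ++ (false ∷ []))

wordJ : (ℕ → ℕ) → ℕ → List Bit
wordJ f = blocks (λ k → replicate (f k) false ++ (true ∷ []))

{-# OPTIONS --safe #-}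
-- Descending 1ᵏ from (a/b, c/d) adds c/d to the left endpoint k times, and a
-- final 0 moves the right endpoint to the new mediant; this is exactly one step
-- of I.  Dually 0ᵏ1 is one step of J.  The theorem follows by induction on the
-- number of blocks, since F of a concatenation is F of the second word started
-- at the pair reached by the first.
module Submission where

open import Defs
open import Data.Nat using (ℕ; suc; _+_; _*_)
open import Data.Nat.Properties using (+-assoc; +-comm; +-identityʳ)
open import Data.Bool using (true; false)
open import Data.List using (List; []; _∷_; _++_; replicate)
open import Data.Product using (_×_; _,_)
open import Relation.Binary.PropositionalEquality
  using (_≡_; refl; sym; cong; cong₂; module ≡-Reasoning)

farey-from-++ : ∀ p xs ys → farey-from p (xs ++ ys) ≡ farey-from (farey-from p xs) ys
farey-from-++ p []       ys = refl
farey-from-++ p (x ∷ xs) ys = farey-from-++ (fstep p x) xs ys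

farey-from-blocks : (g : ℕ → FracPair) (w : ℕ → List Bit) →
  (∀ n → farey-from (g n) (w n) ≡ g (suc n)) →
  ∀ n → farey-from (g 0) (blocks w n) ≡ g (suc n)
farey-from-blocks g w step 0       = step 0
farey-from-blocks g w step (suc n) = begin
  farey-from (g 0) (blocks w n ++ w (suc n))     ≡⟨ farey-from-++ (g 0) (blocks w n) (w (suc n)) ⟩
  farey-from (farey-from (g 0) (blocks w n)) (w (suc n))
    ≡⟨ cong (λ p → farey-from p (w (suc n))) (farey-from-blocks g w step n) ⟩
  farey-from (g (suc n)) (w (suc n))             ≡⟨ step (suc n) ⟩
  g (suc (suc n))                                ∎
  where open ≡-Reasoning

farey-from-replicate-true : ∀ k a b c d →
  farey-from ((a , b) , (c , d)) (replicate k true) ≡ ((a + k * c , b + k * d) , (c , d))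
farey-from-replicate-true 0       a b c d =
  cong₂ (λ u v → ((u , v) , (c , d))) (sym (+-identityʳ a)) (sym (+-identityʳ b))
farey-from-replicate-true (suc k) a b c d = begin
  farey-from ((a + c , b + d) , (c , d)) (replicate k true)
    ≡⟨ farey-from-replicate-true k (a + c) (b + d) c d ⟩
  ((a + c + k * c , b + d + k * d) , (c , d))
    ≡⟨ cong₂ (λ u v → ((u , v) , (c , d))) (+-assoc a c (k * c)) (+-assoc b d (k * d)) ⟩
  ((a + suc k * c , b + suc k * d) , (c , d)) ∎
  where open ≡-Reasoning

farey-from-replicate-false : ∀ k a b c d →
  farey-from ((a , b) , (c , d)) (replicate k false) ≡ ((a , b) , (k * a + c , k * b + d))
farey-from-replicate-false 0       a b c d = refl
farey-from-replicate-false (suc k) a b c d = begin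
  farey-from ((a , b) , (a + c , b + d)) (replicate k false)
    ≡⟨ farey-from-replicate-false k a b (a + c) (b + d) ⟩
  ((a , b) , (k * a + (a + c) , k * b + (b + d)))
    ≡⟨ cong₂ (λ u v → ((a , b) , (u , v))) (sym (+-assoc (k * a) a c)) (sym (+-assoc (k * b) b d)) ⟩
  ((a , b) , (k * a + a + c , k * b + b + d))
    ≡⟨ cong₂ (λ u v → ((a , b) , (u + c , v + d))) (+-comm (k * a) a) (+-comm (k * b) b) ⟩
  ((a , b) , (suc k * a + c , suc k * b + d)) ∎
  where open ≡-Reasoning

farey-from-1ᵏ0 : ∀ k a b c d →
  farey-from ((a , b) , (c , d)) (replicate k true ++ false ∷ []) ≡
    ((a + k * c , b + k * d) , (a + k * c + c , b + k * d + d))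
farey-from-1ᵏ0 k a b c d = begin
  farey-from ((a , b) , (c , d)) (replicate k true ++ false ∷ [])
    ≡⟨ farey-from-++ ((a , b) , (c , d)) (replicate k true) (false ∷ []) ⟩
  fstep (farey-from ((a , b) , (c , d)) (replicate k true)) false
    ≡⟨ cong (λ p → fstep p false) (farey-from-replicate-true k a b c d) ⟩
  ((a + k * c , b + k * d) , (a + k * c + c , b + k * d + d)) ∎
  where open ≡-Reasoning

farey-from-0ᵏ1 : ∀ k a b c d →
  farey-from ((a , b) , (c , d)) (replicate k false ++ true ∷ []) ≡
    ((a + k * a + c , b + k * b + d) , (k * a + c , k * b + d))
farey-from-0ᵏ1 k a b c d = begin
  farey-from ((a , b) , (c , d)) (replicate k false ++ true ∷ [])
    ≡⟨ farey-from-++ ((a , b) , (c , d)) (replicate k false) (true ∷ []) ⟩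
  fstep (farey-from ((a , b) , (c , d)) (replicate k false)) true
    ≡⟨ cong (λ p → fstep p true) (farey-from-replicate-false k a b c d) ⟩
  ((a + (k * a + c) , b + (k * b + d)) , (k * a + c , k * b + d))
    ≡⟨ cong₂ (λ u v → ((u , v) , (k * a + c , k * b + d))) (sym (+-assoc a (k * a) c)) (sym (+-assoc b (k * b) d)) ⟩
  ((a + k * a + c , b + k * b + d) , (k * a + c , k * b + d)) ∎
  where open ≡-Reasoning

mainTheorem11 : (f : ℕ → ℕ) (n : ℕ) →
    (I f (suc n) ≡ F (wordI f n)) × (J f (suc n) ≡ F (wordJ f n))
mainTheorem11 f n =
  sym (farey-from-blocks (I f) _ (λ m → farey-from-1ᵏ0 (f m) _ _ _ _) n) ,
  sym (farey-from-blocks (J f) _ (λ m → farey-from-0ᵏ1 (f m) _ _ _ _) n)
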